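{- Let $G$ be a graph on vertices $1,\dots,n$, and let $A=[a_{i,j}]\in\mathcal{S}(G)$ and $B=[b_{i,j}]\in\mathcal{S}(\overline{G})$. If $AB=O$, then $a_{i,i}=0$ or $b_{i,i}=0$ for each $1\le i\le n$.
   Context: For a graph $G$ with vertex set $\{1,\dots,n\}$, $\mathcal{S}(G)$ is the set of real symmetric $n\times n$ matrices $A=[a_{i,j}]$ such that for $i\neq j$, $a_{i,j}\neq 0$ if and only if $ij\in E(G)$ (diagonal entries are unrestricted). $\overline{G}$ is the complement of $G$. -}

module Defs where

open import Level using (Level) renaming (suc to lsuc)
open import Data.Nat using (ℕ; zero) renaming (suc to sucℕ)
open import Data.Fin using (Fin; zero; suc)
open import Data.Bool using (Bool; true; false; not; if_then_else_)
open import Data.Fin.Properties using (_≟_)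
open import Relation.Nullary.Decidable using (⌊_⌋)
open import Data.Product using (Σ; _×_; _,_; ∃)
open import Data.Sum using (_⊎_)
open import Relation.Binary.PropositionalEquality using (_≡_; _≢_)
open import Relation.Nullary using (¬_)

-- The real numbers, axiomatised as a (classical) complete ordered field.
-- agda-stdlib has no real numbers; we quantify over an arbitrary model of
-- the standard axioms of ℝ (any two models are isomorphic).

record RealField (ℓ : Level) : Set (lsuc ℓ) where
  infixl 6 _+_
  infixl 7 _*_
  infix  4 _<_ _≤_
  field
    ℝ    : Set ℓ
    0ℝ   : ℝ
    1ℝ   : ℝ
    _+_  : ℝ → ℝ → ℝ
    _*_  : ℝ → ℝ → ℝ
    -_   : ℝ → ℝ
    _<_  : ℝ → ℝ → Set ℓ
    +-assoc     : ∀ x y z → (x + y) + z ≡ x + (y + z)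
    +-comm      : ∀ x y → x + y ≡ y + x
    +-identityˡ : ∀ x → 0ℝ + x ≡ x
    -‿inverseˡ  : ∀ x → (- x) + x ≡ 0ℝ
    *-assoc     : ∀ x y z → (x * y) * z ≡ x * (y * z)
    *-comm      : ∀ x y → x * y ≡ y * x
    *-identityˡ : ∀ x → 1ℝ * x ≡ x
    distribˡ    : ∀ x y z → x * (y + z) ≡ (x * y) + (x * z)
    0≢1         : 0ℝ ≢ 1ℝ
    inverse     : ∀ x → x ≢ 0ℝ → Σ ℝ (λ y → y * x ≡ 1ℝ)
    <-irrefl    : ∀ x → ¬ (x < x)
    <-trans     : ∀ {x y z} → x < y → y < z → x < z
    trichotomy  : ∀ x y → x < y ⊎ (x ≡ y ⊎ y < x)
    +-mono-<    : ∀ {x y} z → x < y → x + z < y + z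
    *-pos       : ∀ {x y} → 0ℝ < x → 0ℝ < y → 0ℝ < x * y
  _≤_ : ℝ → ℝ → Set ℓ
  x ≤ y = x < y ⊎ x ≡ y
  field
    completeness : (P : ℝ → Set ℓ) → Σ ℝ P → Σ ℝ (λ b → ∀ x → P x → x ≤ b) →
                   Σ ℝ (λ s → (∀ x → P x → x ≤ s) × (∀ b → (∀ x → P x → x ≤ b) → s ≤ b))

record Graph (n : ℕ) : Set where
  field
    adj     : Fin n → Fin n → Bool
    symm    : ∀ i j → adj i j ≡ adj j i
    loopless : ∀ i → adj i i ≡ false

open Graph public

complementAdj : ∀ {n} → (Fin n → Fin n → Bool) → Fin n → Fin n → Bool
complementAdj a i j = if ⌊ i ≟ j ⌋ then false else not (a i j)

module _ {ℓ : Level} (R : RealField ℓ) where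
  open RealField R

  Matrix : ℕ → Set ℓ
  Matrix n = Fin n → Fin n → ℝ

  sumFin : ∀ {n} → (Fin n → ℝ) → ℝ
  sumFin {zero}   f = 0ℝ
  sumFin {sucℕ n} f = f zero + sumFin (λ k → f (suc k))

  _·_ : ∀ {n} → Matrix n → Matrix n → Matrix n
  (A · B) i j = sumFin (λ k → A i k * B k j)

  O : ∀ {n} → Matrix n
  O i j = 0ℝ

  InS : ∀ {n} → (Fin n → Fin n → Bool) → Matrix n → Set ℓ
  InS {n} a A = (∀ i j → A i j ≡ A j i)
              × (∀ i j → i ≢ j → (A i j ≢ 0ℝ → a i j ≡ true) × (a i j ≡ true → A i j ≢ 0ℝ))

{-# OPTIONS --safe #-}
-- For i ≠ k the entries A i k and B k i cannot both be nonzero, since ik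
-- would then be an edge of both G and its complement. Hence the diagonal
-- entry (AB) i i = Σ_k A i k B k i collapses to A i i B i i, which is 0 by
-- AB = O, and a field has no zero divisors.
module Submission where

open import Defs
open import Level using (Level)
open import Data.Nat using (ℕ)
open import Data.Fin using (Fin; zero; suc)
open import Data.Fin.Properties using (_≟_; suc-injective)
open import Data.Sum using (_⊎_; inj₁; inj₂)
open import Data.Product using (_×_; _,_; proj₁)
open import Data.Bool using (Bool; true; false; not)
open import Function using (_∘_)
open import Relation.Nullary using (yes; no; contradiction)
open import Relation.Binary.PropositionalEquality

complementAdj-≢ : ∀ {n} (a : Fin n → Fin n → Bool) {i j : Fin n} →
                  i ≢ j → complementAdj a i j ≡ not (a i j)
complementAdj-≢ a {i} {j} i≢j with i ≟ j
... | yes i≡j = contradiction i≡j i≢j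
... | no _    = refl

edge⇒¬complementEdge : ∀ {n} (G : Graph n) {i j : Fin n} → i ≢ j →
                       adj G i j ≡ true → complementAdj (adj G) j i ≢ true
edge⇒¬complementEdge G {i} {j} i≢j ij∈G ji∈Gᶜ = false≢true (begin
  false                      ≡⟨ cong not (sym ij∈G) ⟩
  not (adj G i j)            ≡⟨ cong not (symm G i j) ⟩
  not (adj G j i)            ≡⟨ sym (complementAdj-≢ (adj G) (≢-sym i≢j)) ⟩
  complementAdj (adj G) j i  ≡⟨ ji∈Gᶜ ⟩
  true                       ∎)
  where
  open ≡-Reasoning
  false≢true : false ≢ true
  false≢true ()

module FieldProperties {ℓ : Level} (R : RealField ℓ) where
  open RealField R
  open ≡-Reasoning

  ≡0-dec : ∀ x → x ≡ 0ℝ ⊎ x ≢ 0ℝ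
  ≡0-dec x with trichotomy x 0ℝ
  ... | inj₁ x<0        = inj₂ λ x≡0 → <-irrefl 0ℝ (subst (_< 0ℝ) x≡0 x<0)
  ... | inj₂ (inj₁ x≡0) = inj₁ x≡0
  ... | inj₂ (inj₂ 0<x) = inj₂ λ x≡0 → <-irrefl 0ℝ (subst (0ℝ <_) x≡0 0<x)

  +-identityʳ : ∀ x → x + 0ℝ ≡ x
  +-identityʳ x = trans (+-comm x 0ℝ) (+-identityˡ x)

  x≡x+x⇒x≡0 : ∀ x → x ≡ x + x → x ≡ 0ℝ
  x≡x+x⇒x≡0 x x≡x+x = begin
    x                ≡⟨ sym (+-identityˡ x) ⟩
    0ℝ + x           ≡⟨ cong (_+ x) (sym (-‿inverseˡ x)) ⟩
    ((- x) + x) + x  ≡⟨ +-assoc (- x) x x ⟩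
    (- x) + (x + x)  ≡⟨ cong ((- x) +_) (sym x≡x+x) ⟩
    (- x) + x        ≡⟨ -‿inverseˡ x ⟩
    0ℝ               ∎

  zeroʳ : ∀ x → x * 0ℝ ≡ 0ℝ
  zeroʳ x = x≡x+x⇒x≡0 (x * 0ℝ)
    (trans (cong (x *_) (sym (+-identityˡ 0ℝ))) (distribˡ x 0ℝ 0ℝ))

  zeroˡ : ∀ x → 0ℝ * x ≡ 0ℝ
  zeroˡ x = trans (*-comm 0ℝ x) (zeroʳ x)

  x*y≡0⇒x≡0⊎y≡0 : ∀ x y → x * y ≡ 0ℝ → x ≡ 0ℝ ⊎ y ≡ 0ℝ
  x*y≡0⇒x≡0⊎y≡0 x y x*y≡0 with ≡0-dec x
  ... | inj₁ x≡0 = inj₁ x≡0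
  ... | inj₂ x≢0 with inverse x x≢0
  ... | x⁻¹ , x⁻¹*x≡1 = inj₂ (begin
    y              ≡⟨ sym (*-identityˡ y) ⟩
    1ℝ * y         ≡⟨ cong (_* y) (sym x⁻¹*x≡1) ⟩
    (x⁻¹ * x) * y  ≡⟨ *-assoc x⁻¹ x y ⟩
    x⁻¹ * (x * y)  ≡⟨ cong (x⁻¹ *_) x*y≡0 ⟩
    x⁻¹ * 0ℝ       ≡⟨ zeroʳ x⁻¹ ⟩
    0ℝ             ∎)

  x≢0×y≢0⊎x*y≡0 : ∀ x y → ((x ≢ 0ℝ) × (y ≢ 0ℝ)) ⊎ x * y ≡ 0ℝ
  x≢0×y≢0⊎x*y≡0 x y with ≡0-dec x | ≡0-dec y
  ... | inj₁ x≡0 | _        = inj₂ (trans (cong (_* y) x≡0) (zeroˡ y))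
  ... | inj₂ _   | inj₁ y≡0 = inj₂ (trans (cong (x *_) y≡0) (zeroʳ x))
  ... | inj₂ x≢0 | inj₂ y≢0 = inj₁ (x≢0 , y≢0)

  sumFin-zero : ∀ {n} (f : Fin n → ℝ) → (∀ k → f k ≡ 0ℝ) → sumFin R f ≡ 0ℝ
  sumFin-zero {ℕ.zero}  f f≡0 = refl
  sumFin-zero {ℕ.suc n} f f≡0 =
    trans (cong₂ _+_ (f≡0 zero) (sumFin-zero (f ∘ suc) (f≡0 ∘ suc))) (+-identityˡ 0ℝ)

  sumFin-single : ∀ {n} (f : Fin n → ℝ) (i : Fin n) →
                  (∀ k → k ≢ i → f k ≡ 0ℝ) → sumFin R f ≡ f i
  sumFin-single f zero f≡0 =
    trans (cong (f zero +_) (sumFin-zero (f ∘ suc) λ k → f≡0 (suc k) λ ()))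
          (+-identityʳ (f zero))
  sumFin-single f (suc i) f≡0 =
    trans (cong (_+ sumFin R (f ∘ suc)) (f≡0 zero λ ()))
          (trans (+-identityˡ _)
                 (sumFin-single (f ∘ suc) i λ k k≢i → f≡0 (suc k) (k≢i ∘ suc-injective)))

module _ {ℓ : Level} (R : RealField ℓ) where
  open RealField R
  open FieldProperties R

  offDiagonal-products-vanish : ∀ {n} (G : Graph n) (A B : Matrix R n) →
    InS R (adj G) A → InS R (complementAdj (adj G)) B →
    ∀ {i k} → k ≢ i → A i k * B k i ≡ 0ℝ
  offDiagonal-products-vanish G A B (_ , A-pattern) (_ , B-pattern) {i} {k} k≢i
    with x≢0×y≢0⊎x*y≡0 (A i k) (B k i)
  ... | inj₂ A*B≡0       = A*B≡0
  ... | inj₁ (A≢0 , B≢0) = contradiction (proj₁ (B-pattern k i k≢i) B≢0)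
    (edge⇒¬complementEdge G (≢-sym k≢i) (proj₁ (A-pattern i k (≢-sym k≢i)) A≢0))

  ·-diagonal : ∀ {n} (A B : Matrix R n) (i : Fin n) →
    (∀ {k} → k ≢ i → A i k * B k i ≡ 0ℝ) → _·_ R A B i i ≡ A i i * B i i
  ·-diagonal A B i offDiagonal≡0 = sumFin-single (λ k → A i k * B k i) i λ k → offDiagonal≡0

lemma2p2 : ∀ {ℓ : Level} (R : RealField ℓ) (n : ℕ) (G : Graph n) (A B : Matrix R n) →
           InS R (adj G) A → InS R (complementAdj (adj G)) B →
           _·_ R A B ≡ O R →
           ∀ (i : Fin n) → A i i ≡ RealField.0ℝ R ⊎ B i i ≡ RealField.0ℝ R
lemma2p2 R n G A B A∈S[G] B∈S[Gᶜ] AB≡O i =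
  x*y≡0⇒x≡0⊎y≡0 (A i i) (B i i) (begin
    A i i * B i i    ≡⟨ sym (·-diagonal R A B i (offDiagonal-products-vanish R G A B A∈S[G] B∈S[Gᶜ])) ⟩
    _·_ R A B i i    ≡⟨ cong (λ M → M i i) AB≡O ⟩
    0ℝ               ∎)
  where
  open RealField R
  open FieldProperties R
  open ≡-Reasoning
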